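{- Let $S$ be a signed graph whose underlying graph is simple and connected and all of whose edges are negative. Then $S$ is a parity signed graph if and only if its underlying graph is a spanning subgraph of a complete bipartite graph $K_{m,n}$ with $|m-n|\le 1$.
   Context: A signed graph is a pair $S=(G,\sigma)$ with $G$ a graph and $\sigma:E(G)\to\{+,-\}$. For a graph $G$ with $n$ vertices and a bijection $f:V(G)\to\{1,\dots,n\}$, define $\sigma_f(uv)=+$ if $f(u),f(v)$ have the same parity and $\sigma_f(uv)=-$ otherwise. $S$ is a parity signed graph if $\sigma=\sigma_f$ for some such bijection $f$. -}

module Defs where

open import Data.Nat using (ℕ; suc; _%_; _≤_)
open import Data.Nat.Properties using (_≟_)
open import Data.Fin using (Fin; toℕ)
open import Data.Sum using (_⊎_; inj₁; inj₂)
open import Data.Bool using (Bool; if_then_else_)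
open import Data.Product using (Σ; _×_; ∃; ∃-syntax)
open import Data.Empty using (⊥)
open import Data.Unit using (⊤)
open import Relation.Nullary using (¬_)
open import Relation.Nullary.Decidable using (⌊_⌋)
open import Relation.Binary.PropositionalEquality using (_≡_)
open import Function.Bundles using (_⤖_; Bijection)
open import Level using (0ℓ)

-- A simple graph on the vertex set Fin N: a symmetric, irreflexive
-- adjacency relation (no loops; no multiple edges since an edge is
-- just the relation holding between two vertices).
record SimpleGraph (N : ℕ) : Set₁ where
  field
    Adj    : Fin N → Fin N → Set
    sym    : ∀ {u v} → Adj u v → Adj v u
    irrefl : ∀ {u} → ¬ Adj u u
open SimpleGraph public

data Sign : Set where
  plus minus : Sign

-- The edge uv is given by
-- a proof of Adj u v; σ must assign the same sign to both orientations
-- and must not depend on the particular adjacency proof.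
record SignedGraph (N : ℕ) : Set₁ where
  field
    graph   : SimpleGraph N
    σ       : ∀ u v → Adj graph u v → Sign
    σ-sym   : ∀ u v (e : Adj graph u v) → σ u v e ≡ σ v u (sym graph e)
    σ-irr   : ∀ u v (e e′ : Adj graph u v) → σ u v e ≡ σ u v e′
open SignedGraph public

data Reachable {N : ℕ} (G : SimpleGraph N) : Fin N → Fin N → Set where
  here : ∀ {u} → Reachable G u u
  step : ∀ {u v w} → Adj G u v → Reachable G v w → Reachable G u w

Connected : ∀ {N} → SimpleGraph N → Set
Connected G = ∀ u v → Reachable G u v

sameParity : ℕ → ℕ → Bool
sameParity a b = ⌊ a % 2 ≟ b % 2 ⌋

-- A labelling f : V(G) → {1,…,N}, bijective.  Vertex u gets the label
-- suc (toℕ (f u)) ∈ {1,…,N}.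
label : ∀ {N} → (Fin N ⤖ Fin N) → Fin N → ℕ
label f u = suc (toℕ (Bijection.to f u))

paritySign : ∀ {N} → (Fin N ⤖ Fin N) → Fin N → Fin N → Sign
paritySign f u v = if sameParity (label f u) (label f v) then plus else minus

IsParitySigned : ∀ {N} → SignedGraph N → Set
IsParitySigned {N} S =
  ∃[ f ] (∀ u v (e : Adj (graph S) u v) → σ S u v e ≡ paritySign f u v)

AllNegative : ∀ {N} → SignedGraph N → Set
AllNegative S = ∀ u v (e : Adj (graph S) u v) → σ S u v e ≡ minus

KAdj : ∀ {a b} → Fin a ⊎ Fin b → Fin a ⊎ Fin b → Set
KAdj (inj₁ _) (inj₂ _) = ⊤
KAdj (inj₂ _) (inj₁ _) = ⊤
KAdj _        _        = ⊥

SpanningSubgraphOfK : ∀ {N} → SimpleGraph N → ℕ → ℕ → Set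
SpanningSubgraphOfK {N} G a b =
  Σ (Fin N ⤖ (Fin a ⊎ Fin b)) λ φ →
    ∀ u v → Adj G u v → KAdj (Bijection.to φ u) (Bijection.to φ v)

DiffAtMostOne : ℕ → ℕ → Set
DiffAtMostOne a b = (a ≤ suc b) × (b ≤ suc a)

-- All edges negative means every edge joins labels of opposite parity, so a
-- parity labelling is exactly a bipartition of V(G) into the vertices with
-- odd and with even labels, whose sizes ⌈N/2⌉ and ⌊N/2⌋ differ by at most
-- one.  Conversely a bipartition with parts of sizes m ≥ n ≥ m − 1 forces
-- {m, n} = {⌈N/2⌉, ⌊N/2⌋}, and enumerating the larger part by the odd labels
-- and the smaller by the even ones gives a parity labelling.
module Submission where

open import Defs
open import Data.Nat using (ℕ; zero; suc; _+_; _%_; _≤_; s≤s; ⌊_/2⌋; ⌈_/2⌉; parity)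
open import Data.Nat.Properties
  using (_≟_; +-suc; ≤-total; n≤1+n; m≤n⇒m≤1+n; ⌈n/2⌉-mono; ⌊n/2⌋≤⌈n/2⌉)
open import Data.Parity using (Parity; 0ℙ; 1ℙ; _⁻¹)
open import Data.Parity.Properties using (suc-homo-⁻¹)
open import Data.Fin using (Fin; toℕ; zero; suc)
open import Data.Fin.Properties using (+↔⊎)
open import Data.Fin.Permutation using (↔⇒≡)
open import Data.Bool using (true; false; if_then_else_)
open import Data.Sum using (_⊎_; inj₁; inj₂; swap)
open import Data.Sum.Properties using (swap-↔)
open import Data.Product using (_×_; _,_; ∃-syntax)
import Data.Product as Product
open import Data.Empty using (⊥-elim)
open import Data.Unit using (tt)
open import Relation.Nullary using (yes; no)
open import Relation.Binary.PropositionalEquality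
  using (_≡_; _≢_; refl; trans; cong; subst₂; module ≡-Reasoning)
  renaming (sym to ≡-sym)
open import Function using (_∘_)
open import Function.Bundles using (_⇔_; mk⇔; _⤖_; _↔_; Bijection; mk↔ₛ′; Equivalence)
open import Function.Properties.Inverse using (↔⇒⤖)
open import Function.Properties.Bijection using (⤖⇒↔)
open import Function.Properties.Equivalence using () renaming (trans to ⇔-trans; sym to ⇔-sym)
open import Function.Construct.Composition using (_⤖-∘_; _↔-∘_)
open import Function.Construct.Symmetry using (⤖-sym; ↔-sym)

private
  variable
    N m n : ℕ

parity≡⇔%2≡ : ∀ a b → parity a ≡ parity b ⇔ a % 2 ≡ b % 2
parity≡⇔%2≡ a b = mk⇔
  (λ eq → trans (%2≡⟦parity⟧ a) (trans (cong ⟦_⟧ eq) (≡-sym (%2≡⟦parity⟧ b))))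
  (λ eq → ⟦⟧-injective (trans (≡-sym (%2≡⟦parity⟧ a)) (trans eq (%2≡⟦parity⟧ b))))
  where
  ⟦_⟧ : Parity → ℕ
  ⟦ 0ℙ ⟧ = 0
  ⟦ 1ℙ ⟧ = 1

  ⟦⟧-injective : ∀ {p q} → ⟦ p ⟧ ≡ ⟦ q ⟧ → p ≡ q
  ⟦⟧-injective {0ℙ} {0ℙ} _ = refl
  ⟦⟧-injective {1ℙ} {1ℙ} _ = refl

  %2≡⟦parity⟧ : ∀ a → a % 2 ≡ ⟦ parity a ⟧
  %2≡⟦parity⟧ zero          = refl
  %2≡⟦parity⟧ (suc zero)    = refl
  %2≡⟦parity⟧ (suc (suc a)) = %2≡⟦parity⟧ a

sameParity≡false⇔parity≢ : ∀ a b → sameParity a b ≡ false ⇔ parity a ≢ parity b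
sameParity≡false⇔parity≢ a b with a % 2 ≟ b % 2
... | yes a≡b = mk⇔ (λ ()) (λ a≢b → ⊥-elim (a≢b (Equivalence.from (parity≡⇔%2≡ a b) a≡b)))
... | no  a≢b = mk⇔ (λ _ → a≢b ∘ Equivalence.to (parity≡⇔%2≡ a b)) (λ _ → refl)

if-then-minus≡minus⇔ : ∀ b → (if b then plus else minus) ≡ minus ⇔ b ≡ false
if-then-minus≡minus⇔ true  = mk⇔ (λ ()) (λ ())
if-then-minus≡minus⇔ false = mk⇔ (λ _ → refl) (λ _ → refl)

paritySign≡minus⇔ : (f : Fin N ⤖ Fin N) (u v : Fin N) →
  paritySign f u v ≡ minus ⇔ parity (label f u) ≢ parity (label f v)
paritySign≡minus⇔ f u v =
  ⇔-trans (if-then-minus≡minus⇔ _) (sameParity≡false⇔parity≢ (label f u) (label f v))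

-- The two parts of K_{m,n}; the first part holds the odd labels.
side : ∀ {a b} → Fin a ⊎ Fin b → Parity
side (inj₁ _) = 1ℙ
side (inj₂ _) = 0ℙ

KAdj⇔side≢ : ∀ {a b} (x y : Fin a ⊎ Fin b) → KAdj x y ⇔ side x ≢ side y
KAdj⇔side≢ (inj₁ _) (inj₁ _) = mk⇔ (λ ()) (λ ne → ne refl)
KAdj⇔side≢ (inj₁ _) (inj₂ _) = mk⇔ (λ _ ()) (λ _ → tt)
KAdj⇔side≢ (inj₂ _) (inj₁ _) = mk⇔ (λ _ ()) (λ _ → tt)
KAdj⇔side≢ (inj₂ _) (inj₂ _) = mk⇔ (λ ()) (λ ne → ne refl)

KAdj-swap : ∀ {a b} {x y : Fin a ⊎ Fin b} → KAdj x y → KAdj (swap x) (swap y)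
KAdj-swap {x = inj₁ _} {inj₂ _} _ = tt
KAdj-swap {x = inj₂ _} {inj₁ _} _ = tt

-- Vertex k of Fin N (label k + 1) goes to inj₁ ⌊k/2⌋ if k is even and to
-- inj₂ ⌊k/2⌋ if k is odd; ⌈ suc N /2⌉ = suc ⌊ N /2⌋ and ⌊ suc N /2⌋ = ⌈ N /2⌉
-- hold by computation.
shiftHalves : Fin ⌈ N /2⌉ ⊎ Fin ⌊ N /2⌋ → Fin ⌈ suc N /2⌉ ⊎ Fin ⌊ suc N /2⌋
shiftHalves (inj₁ i) = inj₂ i
shiftHalves (inj₂ j) = inj₁ (suc j)

toHalves : ∀ N → Fin N → Fin ⌈ N /2⌉ ⊎ Fin ⌊ N /2⌋
toHalves (suc N) zero    = inj₁ zero
toHalves (suc N) (suc k) = shiftHalves {N} (toHalves N k)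

fromHalves : ∀ N → Fin ⌈ N /2⌉ ⊎ Fin ⌊ N /2⌋ → Fin N
fromHalves (suc N) (inj₁ zero)    = zero
fromHalves (suc N) (inj₁ (suc j)) = suc (fromHalves N (inj₂ j))
fromHalves (suc N) (inj₂ i)       = suc (fromHalves N (inj₁ i))

fromHalves-shiftHalves : ∀ N (x : Fin ⌈ N /2⌉ ⊎ Fin ⌊ N /2⌋) →
  fromHalves (suc N) (shiftHalves {N} x) ≡ suc (fromHalves N x)
fromHalves-shiftHalves N (inj₁ i) = refl
fromHalves-shiftHalves N (inj₂ j) = refl

toHalves∘fromHalves : ∀ N (x : Fin ⌈ N /2⌉ ⊎ Fin ⌊ N /2⌋) → toHalves N (fromHalves N x) ≡ x
toHalves∘fromHalves (suc N) (inj₁ zero)    = refl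
toHalves∘fromHalves (suc N) (inj₁ (suc j)) = cong (shiftHalves {N}) (toHalves∘fromHalves N (inj₂ j))
toHalves∘fromHalves (suc N) (inj₂ i)       = cong (shiftHalves {N}) (toHalves∘fromHalves N (inj₁ i))

fromHalves∘toHalves : ∀ N (k : Fin N) → fromHalves N (toHalves N k) ≡ k
fromHalves∘toHalves (suc N) zero    = refl
fromHalves∘toHalves (suc N) (suc k) =
  trans (fromHalves-shiftHalves N (toHalves N k)) (cong suc (fromHalves∘toHalves N k))

halves : ∀ N → Fin N ↔ (Fin ⌈ N /2⌉ ⊎ Fin ⌊ N /2⌋)
halves N = mk↔ₛ′ (toHalves N) (fromHalves N) (toHalves∘fromHalves N) (fromHalves∘toHalves N)

side-toHalves : ∀ N (k : Fin N) → side (toHalves N k) ≡ parity (suc (toℕ k))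
side-toHalves (suc N) zero    = refl
side-toHalves (suc N) (suc k) = begin
  side (shiftHalves {N} (toHalves N k)) ≡⟨ side-shiftHalves (toHalves N k) ⟩
  side (toHalves N k) ⁻¹                ≡⟨ cong _⁻¹ (side-toHalves N k) ⟩
  parity (suc (toℕ k)) ⁻¹               ≡⟨ suc-homo-⁻¹ (toℕ k) ⟩
  parity (toℕ k)                        ∎
  where
  open ≡-Reasoning
  side-shiftHalves : ∀ x → side (shiftHalves {N} x) ≡ side x ⁻¹
  side-shiftHalves (inj₁ _) = refl
  side-shiftHalves (inj₂ _) = refl

paritySign≡minus⇔KAdj : (f : Fin N ⤖ Fin N) (u v : Fin N) →
  paritySign f u v ≡ minus ⇔
  KAdj (toHalves N (Bijection.to f u)) (toHalves N (Bijection.to f v))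
paritySign≡minus⇔KAdj {N} f u v = ⇔-trans (paritySign≡minus⇔ f u v)
  (subst₂ (λ p q → p ≢ q ⇔ KAdj x y) (side-toHalves N (Bijection.to f u))
    (side-toHalves N (Bijection.to f v)) (⇔-sym (KAdj⇔side≢ x y)))
  where
  x y : Fin ⌈ N /2⌉ ⊎ Fin ⌊ N /2⌋
  x = toHalves N (Bijection.to f u)
  y = toHalves N (Bijection.to f v)

allNegative⇒parity⇔halves : (S : SignedGraph N) → AllNegative S →
  IsParitySigned S ⇔ SpanningSubgraphOfK (graph S) ⌈ N /2⌉ ⌊ N /2⌋
allNegative⇒parity⇔halves {N} S neg = mk⇔ halvesOfLabelling labellingOfHalves
  where
  halvesOfLabelling : IsParitySigned S → SpanningSubgraphOfK (graph S) ⌈ N /2⌉ ⌊ N /2⌋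
  halvesOfLabelling (f , σ≡σf) = ↔⇒⤖ (halves N) ⤖-∘ f , λ u v e →
    Equivalence.to (paritySign≡minus⇔KAdj f u v) (trans (≡-sym (σ≡σf u v e)) (neg u v e))

  labellingOfHalves : SpanningSubgraphOfK (graph S) ⌈ N /2⌉ ⌊ N /2⌋ → IsParitySigned S
  labellingOfHalves (ψ , ψ-KAdj) = f , λ u v e →
    trans (neg u v e) (≡-sym (Equivalence.from (paritySign≡minus⇔KAdj f u v)
      (subst₂ KAdj (≡-sym (toHalves∘fromHalves N _)) (≡-sym (toHalves∘fromHalves N _))
        (ψ-KAdj u v e))))
    where
    f : Fin N ⤖ Fin N
    f = ⤖-sym (↔⇒⤖ (halves N)) ⤖-∘ ψ

SpanningSubgraphOfK-swap : (G : SimpleGraph N) →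
  SpanningSubgraphOfK G m n → SpanningSubgraphOfK G n m
SpanningSubgraphOfK-swap G (φ , φ-KAdj) = ↔⇒⤖ swap-↔ ⤖-∘ φ , λ u v → KAdj-swap ∘ φ-KAdj u v

SpanningSubgraphOfK⇒size : (G : SimpleGraph N) → SpanningSubgraphOfK G m n → N ≡ m + n
SpanningSubgraphOfK⇒size {m = m} {n} G (φ , _) = ↔⇒≡ (↔-sym (+↔⊎ {m} {n}) ↔-∘ ⤖⇒↔ φ)

n≤m≤1+n⇒halves : n ≤ m → m ≤ suc n → m ≡ ⌈ m + n /2⌉ × n ≡ ⌊ m + n /2⌋
n≤m≤1+n⇒halves {zero}  {zero}        _       _       = refl , refl
n≤m≤1+n⇒halves {zero}  {suc zero}    _       _       = refl , refl
n≤m≤1+n⇒halves {zero}  {suc (suc m)} _       (s≤s ())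
n≤m≤1+n⇒halves {suc n} {suc m}       (s≤s p) (s≤s q) rewrite +-suc m n =
  Product.map (cong suc) (cong suc) (n≤m≤1+n⇒halves p q)

SpanningSubgraphOfK-halves : (G : SimpleGraph N) → SpanningSubgraphOfK G m n →
  n ≤ m → m ≤ suc n → SpanningSubgraphOfK G ⌈ N /2⌉ ⌊ N /2⌋
SpanningSubgraphOfK-halves G s n≤m m≤1+n
  with refl ← SpanningSubgraphOfK⇒size G s
  with m≡⌈N/2⌉ , n≡⌊N/2⌋ ← n≤m≤1+n⇒halves n≤m m≤1+n =
  subst₂ (SpanningSubgraphOfK G) m≡⌈N/2⌉ n≡⌊N/2⌋ s

balanced⇔halves : (G : SimpleGraph N) →
  (∃[ m ] ∃[ n ] (DiffAtMostOne m n × SpanningSubgraphOfK G m n)) ⇔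
  SpanningSubgraphOfK G ⌈ N /2⌉ ⌊ N /2⌋
balanced⇔halves {N} G = mk⇔ halvesOfBalanced (λ s → ⌈ N /2⌉ , ⌊ N /2⌋ , halvesBalanced , s)
  where
  halvesBalanced : DiffAtMostOne ⌈ N /2⌉ ⌊ N /2⌋
  halvesBalanced = ⌈n/2⌉-mono (n≤1+n N) , m≤n⇒m≤1+n (⌊n/2⌋≤⌈n/2⌉ N)

  halvesOfBalanced :
    ∃[ m ] ∃[ n ] (DiffAtMostOne m n × SpanningSubgraphOfK G m n) →
    SpanningSubgraphOfK G ⌈ N /2⌉ ⌊ N /2⌋
  halvesOfBalanced (m , n , (m≤1+n , n≤1+m) , s) with ≤-total n m
  ... | inj₁ n≤m = SpanningSubgraphOfK-halves G s n≤m m≤1+n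
  ... | inj₂ m≤n = SpanningSubgraphOfK-halves G (SpanningSubgraphOfK-swap G s) m≤n n≤1+m

theorem6 : ∀ {N : ℕ} (S : SignedGraph N) → Connected (graph S) → AllNegative S →
    IsParitySigned S ⇔ (∃[ m ] ∃[ n ] (DiffAtMostOne m n × SpanningSubgraphOfK (graph S) m n))
theorem6 S _ neg = ⇔-trans (allNegative⇒parity⇔halves S neg) (⇔-sym (balanced⇔halves (graph S)))
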